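{- Let $S$ be a sorting sequence of length $p$ with $r>1$ distinct values and let $k\ge1$. There exists a general solution for $S$ with $f$ fake coins satisfying the height bound for $k$ if and only if there exists a general solution for the reverse sequence $S'$ with $pk-f$ fake coins satisfying the height bound for $k$.
   Context: A sorting sequence of length $p$ is a non-decreasing sequence of $p$ non-negative integers beginning with $0$ in which each entry equals the previous one or exceeds it by $1$ (recording the outcome of sorting $p$ piles of $k$ coins by weight, fake coins lighter). If its distinct entries are $0,\dots,r-1$, let $p_i\ge1$ be the number of entries equal to $i-1$. A general solution with $f$ fake coins is an integer tuple $(f_1,\dots,f_r)$ with $0\le f_1<\dots<f_r$ and $\sum_i p_if_i=f$; it satisfies the height bound for $k$ if $f_r\le k$. The reverse sequence $S'$ is the sorting sequence of length $p$ whose binary representation is the reverse of that of $S$; equivalently it has $r$ distinct values and the number of its entries equal to $i-1$ is $p_{r-i+1}$. (The binary representation of $(s_1,\dots,s_p)$ is the length-$(p-1)$ string whose $j$-th digit is $0$ if $s_{j+1}=s_j$ and $1$ otherwise.) -}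

module Defs where

open import Data.Nat using (ℕ; zero; suc; _+_; _*_; _≤_; _<_; _≟_)
open import Data.Bool using (Bool; true; false; if_then_else_)
open import Data.List using (List; []; _∷_; length; filter; map; reverse; deduplicate; allFin)
open import Data.List.Relation.Unary.Linked using (Linked)
open import Data.Nat.ListAction using (sum)
open import Data.Fin using (Fin; toℕ; fromℕ)
open import Data.Product using (Σ; _×_)
open import Data.Sum using (_⊎_)
open import Data.Unit using (⊤)
open import Relation.Binary.PropositionalEquality using (_≡_)
open import Relation.Nullary.Decidable using (⌊_⌋)

Step : ℕ → ℕ → Set
Step a b = (b ≡ a) ⊎ (b ≡ suc a)

data IsSortingSeq : List ℕ → Set where
  sorting : ∀ {xs} → Linked Step (0 ∷ xs) → IsSortingSeq (0 ∷ xs)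

numDistinct : List ℕ → ℕ
numDistinct s = length (deduplicate _≟_ s)

countEq : ℕ → List ℕ → ℕ
countEq v s = length (filter (_≟ v) s)

-- p_i (i = 1..r, indexed here by Fin r, position i ↦ value toℕ i) = #entries equal to i-1
mult : (s : List ℕ) → Fin (numDistinct s) → ℕ
mult s i = countEq (toℕ i) s

binRep : List ℕ → List Bool
binRep [] = []
binRep (x ∷ []) = []
binRep (x ∷ y ∷ xs) = (if ⌊ y ≟ x ⌋ then false else true) ∷ binRep (y ∷ xs)

fromBin : ℕ → List Bool → List ℕ
fromBin a [] = a ∷ []
fromBin a (b ∷ bs) = a ∷ fromBin (if b then suc a else a) bs

reverseSeq : List ℕ → List ℕ
reverseSeq s = fromBin 0 (reverse (binRep s))

StrictlyIncreasing : {r : ℕ} → (Fin r → ℕ) → Set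
StrictlyIncreasing fs = ∀ i j → toℕ i < toℕ j → fs i < fs j

HeightBound : {r : ℕ} → (Fin r → ℕ) → ℕ → Set
HeightBound {zero} fs k = ⊤
HeightBound {suc m} fs k = fs (fromℕ m) ≤ k

weightedSum : (s : List ℕ) → (Fin (numDistinct s) → ℕ) → ℕ
weightedSum s fs = sum (map (λ i → mult s i * fs i) (allFin (numDistinct s)))

-- general solution for s with f fake coins (f_1 ≥ 0 automatic in ℕ)
IsGeneralSolution : (s : List ℕ) → ℕ → (Fin (numDistinct s) → ℕ) → Set
IsGeneralSolution s f fs = StrictlyIncreasing fs × weightedSum s fs ≡ f

HasBoundedSolution : List ℕ → ℕ → ℕ → Set
HasBoundedSolution s k f =
  Σ (Fin (numDistinct s) → ℕ) (λ fs → IsGeneralSolution s f fs × HeightBound fs k)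

-- A sorting sequence is determined by its list of block sizes p₁, …, p_r, and
-- its reverse sequence has the reversed list of block sizes, so the weight of
-- the value i − 1 in S' is the weight p_{r−i+1} of the value r − i in S.
-- Reflecting a general solution, f_i ↦ k − f_{r−i+1}, therefore turns a
-- solution for S with f fake coins and height bound k into one for S' with
-- Σ p_i (k − f_i) = pk − f fake coins, and it is an involution.  The only
-- asymmetry comes from truncated subtraction: if f > pk then S' would need a
-- solution with 0 fake coins, which is impossible when r > 1.

module Submission where

open import Defs
open import Data.Nat using (ℕ; _*_; _∸_; _≤_; _<_)
open import Data.List using (List; length)
open import Function.Bundles using (_⇔_)
open import Relation.Binary.PropositionalEquality using (_≡_)

open import Data.Bool using (Bool; true; false; if_then_else_)
open import Data.Fin using (Fin; toℕ; fromℕ; opposite) renaming (zero to fzero)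
open import Data.Fin.Permutation as Permutation using ()
open import Data.Fin.Properties using (toℕ-injective; toℕ<n; ≤fromℕ; opposite-prop; opposite-involutive)
open import Data.List
  using ([]; _∷_; _++_; [_]; _∷ʳ_; replicate; reverse; map; filter; deduplicate; allFin; tabulate)
open import Data.List.Properties
  using (filter-accept; filter-reject; filter-++; map-tabulate; reverse-++; unfold-reverse;
         reverse-involutive; ++-assoc; length-++; length-replicate; length-reverse)
open import Data.List.Relation.Unary.Linked using (Linked; [-]; _∷_)
open import Data.Nat using (zero; suc; _+_; _≟_; _≤?_; z≤n; s≤s)
open import Data.Nat.ListAction using (sum)
open import Data.Nat.Properties
open import Data.Product using (Σ; ∃₂; _×_; _,_)
open import Data.Sum using (inj₁; inj₂)
open import Function.Base using (_∘_)
open import Function.Bundles using (mk⇔)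
open import Relation.Binary.PropositionalEquality
  using (_≢_; refl; sym; trans; cong; cong₂; subst; subst₂; module ≡-Reasoning)
open import Relation.Nullary using (yes; no; ¬?; contradiction)
open import Relation.Nullary.Decidable using (⌊_⌋; isYes≗does; dec-true; dec-false)

open import Algebra.Properties.Semiring.Sum +-*-semiring
  using (sum-syntax; sum-cong-≗; ∑-distrib-+; *-distribʳ-sum; ∑-permute; sum-remove)
  renaming (sum to ∑)

private
  variable
    a b k n : ℕ
    c c′ : ℕ → ℕ

∑-allFin : ∀ n (g : Fin n → ℕ) → sum (map g (allFin n)) ≡ ∑[ i < n ] g i
∑-allFin n g = trans (cong sum (map-tabulate (λ i → i) g)) (sum-tabulate n g)
  where
  sum-tabulate : ∀ n (g : Fin n → ℕ) → sum (tabulate g) ≡ ∑[ i < n ] g i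
  sum-tabulate zero    g = refl
  sum-tabulate (suc n) g = cong (g fzero +_) (sum-tabulate n (g ∘ Fin.suc))

∑-opposite : (g : Fin n → ℕ) → ∑[ i < n ] g (opposite i) ≡ ∑[ i < n ] g i
∑-opposite g = sym (∑-permute g Permutation.reverse)

term≤∑ : (g : Fin n → ℕ) (i : Fin n) → g i ≤ ∑ g
term≤∑ {suc n} g i = ≤-trans (m≤m+n (g i) _) (≤-reflexive (sym (sum-remove {i = i} g)))

-- The weight of the value i is c (toℕ i); indexing the weights by ℕ rather
-- than by Fin n lets the number n of values be rewritten on its own.
BoundedSolution : (n : ℕ) → (ℕ → ℕ) → ℕ → ℕ → Set
BoundedSolution n c k f = Σ (Fin n → ℕ) λ h →
  (StrictlyIncreasing h × sum (map (λ i → c (toℕ i) * h i) (allFin n)) ≡ f) × HeightBound h k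

strictlyIncreasing⇒monotone : {h : Fin n → ℕ} → StrictlyIncreasing h →
  ∀ {i j} → toℕ i ≤ toℕ j → h i ≤ h j
strictlyIncreasing⇒monotone inc {i} {j} i≤j with m≤n⇒m<n∨m≡n i≤j
... | inj₁ i<j = <⇒≤ (inc i j i<j)
... | inj₂ i≡j = ≤-reflexive (cong _ (toℕ-injective i≡j))

heightBound⇒bounded : {h : Fin (suc n) → ℕ} → StrictlyIncreasing h → HeightBound h k →
  ∀ i → h i ≤ k
heightBound⇒bounded inc hb i = ≤-trans (strictlyIncreasing⇒monotone inc (≤fromℕ i)) hb

reflect : ℕ → (Fin n → ℕ) → Fin n → ℕ
reflect k h i = k ∸ h (opposite i)

opposite-< : {i j : Fin n} → toℕ i < toℕ j → toℕ (opposite j) < toℕ (opposite i)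
opposite-< {i = i} {j} i<j = subst₂ _<_ (sym (opposite-prop j)) (sym (opposite-prop i))
  (∸-monoʳ-< (s≤s i<j) (toℕ<n j))

reflect-strictlyIncreasing : {h : Fin n → ℕ} → (∀ i → h i ≤ k) →
  StrictlyIncreasing h → StrictlyIncreasing (reflect k h)
reflect-strictlyIncreasing h≤k inc i j i<j =
  ∸-monoʳ-< (inc _ _ (opposite-< i<j)) (h≤k (opposite i))

reflect-weightedSum : (h : Fin n → ℕ) → (∀ i → h i ≤ k) →
  (∀ i → c′ (toℕ i) ≡ c (toℕ (opposite i))) →
  ∑[ i < n ] (c′ (toℕ i) * reflect k h i) + ∑[ i < n ] (c (toℕ i) * h i) ≡ (∑[ i < n ] c (toℕ i)) * k
reflect-weightedSum {n} {k} {c′} {c} h h≤k c′≡c∘opposite = begin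
  ∑[ i < n ] (c′ (toℕ i) * (k ∸ h (opposite i))) + ∑[ i < n ] (c (toℕ i) * h i)
    ≡⟨ cong (_+ ∑ch) (sum-cong-≗ (λ i → cong (_* (k ∸ h (opposite i))) (c′≡c∘opposite i))) ⟩
  ∑[ i < n ] (c (toℕ (opposite i)) * (k ∸ h (opposite i))) + ∑[ i < n ] (c (toℕ i) * h i)
    ≡⟨ cong (_+ ∑ch) (∑-opposite (λ i → c (toℕ i) * (k ∸ h i))) ⟩
  ∑[ i < n ] (c (toℕ i) * (k ∸ h i)) + ∑[ i < n ] (c (toℕ i) * h i)
    ≡⟨ ∑-distrib-+ (λ i → c (toℕ i) * (k ∸ h i)) (λ i → c (toℕ i) * h i) ⟨
  ∑[ i < n ] (c (toℕ i) * (k ∸ h i) + c (toℕ i) * h i)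
    ≡⟨ sum-cong-≗ (λ i → complement (c (toℕ i)) (h≤k i)) ⟩
  ∑[ i < n ] (c (toℕ i) * k)
    ≡⟨ *-distribʳ-sum {n} k (c ∘ toℕ) ⟨
  (∑[ i < n ] c (toℕ i)) * k ∎
  where
  open ≡-Reasoning
  ∑ch = ∑[ i < n ] (c (toℕ i) * h i)
  complement : ∀ w {x} → x ≤ k → w * (k ∸ x) + w * x ≡ w * k
  complement w x≤k = trans (sym (*-distribˡ-+ w _ _)) (cong (w *_) (m∸n+n≡m x≤k))

reflect-solution : ∀ {P f} → (∀ (i : Fin (suc n)) → c′ (toℕ i) ≡ c (toℕ (opposite i))) →
  ∑[ i < suc n ] c (toℕ i) ≡ P →
  BoundedSolution (suc n) c k f → BoundedSolution (suc n) c′ k (P * k ∸ f)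
reflect-solution {n} {c′} {c} {k} {P} {f} c′≡c∘opposite ∑c≡P (h , (inc , ∑ch≡f) , hb) =
  reflect k h , (reflect-strictlyIncreasing h≤k inc , weightedSum≡) ,
  m∸n≤m k (h (opposite (fromℕ n)))
  where
  open ≡-Reasoning
  h≤k : ∀ i → h i ≤ k
  h≤k = heightBound⇒bounded inc hb
  weightedSum≡ : sum (map (λ i → c′ (toℕ i) * reflect k h i) (allFin (suc n))) ≡ P * k ∸ f
  weightedSum≡ = begin
    sum (map (λ i → c′ (toℕ i) * reflect k h i) (allFin (suc n)))
      ≡⟨ ∑-allFin _ (λ i → c′ (toℕ i) * reflect k h i) ⟩
    ∑[ i < suc n ] (c′ (toℕ i) * reflect k h i)
      ≡⟨ m+n∸n≡m _ f ⟨
    ∑[ i < suc n ] (c′ (toℕ i) * reflect k h i) + f ∸ f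
      ≡⟨ cong (λ x → _ + x ∸ f) (trans (sym ∑ch≡f) (∑-allFin _ (λ i → c (toℕ i) * h i))) ⟩
    ∑[ i < suc n ] (c′ (toℕ i) * reflect k h i) + ∑[ i < suc n ] (c (toℕ i) * h i) ∸ f
      ≡⟨ cong (_∸ f) (reflect-weightedSum {c′ = c′} {c = c} h h≤k c′≡c∘opposite) ⟩
    (∑[ i < suc n ] c (toℕ i)) * k ∸ f
      ≡⟨ cong (λ x → x * k ∸ f) ∑c≡P ⟩
    P * k ∸ f ∎

weightedSum-positive : {h : Fin (suc (suc n)) → ℕ} → (∀ i → 1 ≤ c (toℕ i)) →
  StrictlyIncreasing h → 0 < ∑[ i < suc (suc n) ] (c (toℕ i) * h i)
weightedSum-positive {n} {c} {h} c>0 inc =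
  ≤-trans (*-mono-≤ (c>0 last) 0<h[last]) (term≤∑ (λ i → c (toℕ i) * h i) last)
  where
  last = fromℕ (suc n)
  0<h[last] : 0 < h last
  0<h[last] = ≤-trans (s≤s z≤n) (inc fzero last (s≤s z≤n))

solution-duality : ∀ {P} f → (∀ i → 1 ≤ c (toℕ i)) →
  (∀ (i : Fin (suc (suc n))) → c′ (toℕ i) ≡ c (toℕ (opposite i))) →
  ∑[ i < suc (suc n) ] c (toℕ i) ≡ P →
  BoundedSolution (suc (suc n)) c k f ⇔ BoundedSolution (suc (suc n)) c′ k (P * k ∸ f)
solution-duality {c} {n} {c′} {k} {P} f c>0 c′≡c∘opposite ∑c≡P =
  mk⇔ (reflect-solution {c′ = c′} {c = c} c′≡c∘opposite ∑c≡P) reflect-back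
  where
  c≡c′∘opposite : ∀ i → c (toℕ i) ≡ c′ (toℕ (opposite i))
  c≡c′∘opposite i =
    trans (cong (c ∘ toℕ) (sym (opposite-involutive i))) (sym (c′≡c∘opposite (opposite i)))
  ∑c′≡P : ∑[ i < suc (suc n) ] c′ (toℕ i) ≡ P
  ∑c′≡P = trans (sum-cong-≗ c′≡c∘opposite) (trans (∑-opposite (c ∘ toℕ)) ∑c≡P)
  c′>0 : ∀ i → 1 ≤ c′ (toℕ i)
  c′>0 i = ≤-trans (c>0 (opposite i)) (≤-reflexive (sym (c′≡c∘opposite i)))
  reflect-back : BoundedSolution (suc (suc n)) c′ k (P * k ∸ f) →
                 BoundedSolution (suc (suc n)) c k f
  reflect-back sol@(h , (inc , ∑c′h≡Pk∸f) , _) with f ≤? P * k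
  ... | yes f≤Pk = subst (BoundedSolution _ c k) (m∸[m∸n]≡n f≤Pk)
                     (reflect-solution {c′ = c} {c = c′} c≡c′∘opposite ∑c′≡P sol)
  ... | no f≰Pk  = contradiction ∑c′h≡0 (>⇒≢ (weightedSum-positive {c = c′} c′>0 inc))
    where
    ∑c′h≡0 : ∑[ i < suc (suc n) ] (c′ (toℕ i) * h i) ≡ 0
    ∑c′h≡0 = trans (sym (∑-allFin _ (λ i → c′ (toℕ i) * h i)))
      (trans ∑c′h≡Pk∸f (m≤n⇒m∸n≡0 (<⇒≤ (≰⇒> f≰Pk))))

-- The list m₀ ∷ m₁ ∷ … describes blocks of p₁ = m₀ + 1 copies of a,
-- p₂ = m₁ + 1 copies of a + 1, and so on.
blocks : ℕ → List ℕ → List ℕ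
blocks a []       = []
blocks a (m ∷ ms) = replicate (suc m) a ++ blocks (suc a) ms

sortingSeq⇒blocks : ∀ {xs} → Linked Step (a ∷ xs) → ∃₂ λ m ms → a ∷ xs ≡ blocks a (m ∷ ms)
sortingSeq⇒blocks [-] = 0 , [] , refl
sortingSeq⇒blocks {a} (inj₁ refl ∷ steps) with sortingSeq⇒blocks steps
... | m , ms , eq = suc m , ms , cong (a ∷_) eq
sortingSeq⇒blocks {a} (inj₂ refl ∷ steps) with sortingSeq⇒blocks steps
... | m , ms , eq = 0 , m ∷ ms , cong (a ∷_) eq

range : ℕ → ℕ → List ℕ
range a zero    = []
range a (suc n) = a ∷ range (suc a) n

filter-≢-range : a < b → filter (λ y → ¬? (a ≟ y)) (range b n) ≡ range b n
filter-≢-range {n = zero}  a<b = refl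
filter-≢-range {n = suc n} a<b =
  trans (filter-accept (λ y → ¬? (_ ≟ y)) (λ a≡b → <-irrefl a≡b a<b))
        (cong (_ ∷_) (filter-≢-range (m<n⇒m<1+n a<b)))

deduplicate-blocks : ∀ a L → deduplicate _≟_ (blocks a L) ≡ range a (length L)
deduplicate-blocks a []            = refl
deduplicate-blocks a (zero ∷ ms)   =
  cong (a ∷_) (trans (cong (filter (λ y → ¬? (a ≟ y))) (deduplicate-blocks (suc a) ms))
                     (filter-≢-range ≤-refl))
deduplicate-blocks a (suc m ∷ ms)  =
  cong (a ∷_) (trans (cong (filter (λ y → ¬? (a ≟ y))) (deduplicate-blocks a (m ∷ ms)))
                     (trans (filter-reject (λ y → ¬? (a ≟ y)) (λ a≢a → a≢a refl))
                            (filter-≢-range ≤-refl)))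

length-range : ∀ a n → length (range a n) ≡ n
length-range a zero    = refl
length-range a (suc n) = cong suc (length-range (suc a) n)

numDistinct-blocks : ∀ L → numDistinct (blocks 0 L) ≡ length L
numDistinct-blocks L = trans (cong length (deduplicate-blocks 0 L)) (length-range 0 (length L))

countEq-++ : ∀ v xs ys → countEq v (xs ++ ys) ≡ countEq v xs + countEq v ys
countEq-++ v xs ys = trans (cong length (filter-++ (_≟ v) xs ys)) (length-++ (filter (_≟ v) xs))

countEq-replicate : ∀ a n → countEq a (replicate n a) ≡ n
countEq-replicate a zero    = refl
countEq-replicate a (suc n) = trans (cong length (filter-accept (_≟ a) refl)) (cong suc (countEq-replicate a n))

countEq-replicate-≢ : ∀ {v} n → a ≢ v → countEq v (replicate n a) ≡ 0
countEq-replicate-≢ zero    a≢v = refl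
countEq-replicate-≢ (suc n) a≢v = trans (cong length (filter-reject (_≟ _) a≢v)) (countEq-replicate-≢ n a≢v)

countEq-blocks-< : ∀ {v} L → v < a → countEq v (blocks a L) ≡ 0
countEq-blocks-< {a} {v} [] v<a = refl
countEq-blocks-< {a} {v} (m ∷ ms) v<a = begin
  countEq v (replicate (suc m) a ++ blocks (suc a) ms)
    ≡⟨ countEq-++ v (replicate (suc m) a) (blocks (suc a) ms) ⟩
  countEq v (replicate (suc m) a) + countEq v (blocks (suc a) ms)
    ≡⟨ cong₂ _+_ (countEq-replicate-≢ (suc m) (λ a≡v → <-irrefl (sym a≡v) v<a))
                 (countEq-blocks-< ms (m<n⇒m<1+n v<a)) ⟩
  0 ∎
  where open ≡-Reasoning

blockSize : List ℕ → ℕ → ℕ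
blockSize []       v       = 0
blockSize (m ∷ ms) zero    = suc m
blockSize (m ∷ ms) (suc v) = blockSize ms v

countEq-blocks : ∀ a L v → countEq (a + v) (blocks a L) ≡ blockSize L v
countEq-blocks a []       v       = refl
countEq-blocks a (m ∷ ms) zero    = begin
  countEq (a + 0) (replicate (suc m) a ++ blocks (suc a) ms)
    ≡⟨ cong (λ x → countEq x (replicate (suc m) a ++ blocks (suc a) ms)) (+-identityʳ a) ⟩
  countEq a (replicate (suc m) a ++ blocks (suc a) ms)
    ≡⟨ countEq-++ a (replicate (suc m) a) (blocks (suc a) ms) ⟩
  countEq a (replicate (suc m) a) + countEq a (blocks (suc a) ms)
    ≡⟨ cong₂ _+_ (countEq-replicate a (suc m)) (countEq-blocks-< ms ≤-refl) ⟩
  suc m + 0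
    ≡⟨ +-identityʳ (suc m) ⟩
  suc m ∎
  where open ≡-Reasoning
countEq-blocks a (m ∷ ms) (suc v) = begin
  countEq (a + suc v) (replicate (suc m) a ++ blocks (suc a) ms)
    ≡⟨ cong (λ x → countEq x (replicate (suc m) a ++ blocks (suc a) ms)) (+-suc a v) ⟩
  countEq (suc a + v) (replicate (suc m) a ++ blocks (suc a) ms)
    ≡⟨ countEq-++ (suc a + v) (replicate (suc m) a) (blocks (suc a) ms) ⟩
  countEq (suc a + v) (replicate (suc m) a) + countEq (suc a + v) (blocks (suc a) ms)
    ≡⟨ cong₂ _+_ (countEq-replicate-≢ (suc m) (λ a≡ → <-irrefl a≡ (s≤s (m≤m+n a v))))
                 (countEq-blocks (suc a) ms v) ⟩
  blockSize ms v ∎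
  where open ≡-Reasoning

blockSize-positive : ∀ L {v} → v < length L → 0 < blockSize L v
blockSize-positive (m ∷ ms) {zero}  _         = s≤s z≤n
blockSize-positive (m ∷ ms) {suc v} (s≤s v<) = blockSize-positive ms v<

blockSize-++ˡ : ∀ xs ys {v} → v < length xs → blockSize (xs ++ ys) v ≡ blockSize xs v
blockSize-++ˡ (x ∷ xs) ys {zero}  _         = refl
blockSize-++ˡ (x ∷ xs) ys {suc v} (s≤s v<) = blockSize-++ˡ xs ys v<

blockSize-++-length : ∀ xs y ys → blockSize (xs ++ y ∷ ys) (length xs) ≡ suc y
blockSize-++-length []       y ys = refl
blockSize-++-length (x ∷ xs) y ys = blockSize-++-length xs y ys

blockSize-reverse : ∀ L {v} → v < length L → blockSize (reverse L) v ≡ blockSize L (length L ∸ suc v)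
blockSize-reverse (m ∷ ms) {v} (s≤s v≤) with m≤n⇒m<n∨m≡n v≤
... | inj₁ v< = begin
  blockSize (reverse (m ∷ ms)) v
    ≡⟨ cong (λ xs → blockSize xs v) (unfold-reverse m ms) ⟩
  blockSize (reverse ms ++ [ m ]) v
    ≡⟨ blockSize-++ˡ (reverse ms) [ m ] (subst (v <_) (sym (length-reverse ms)) v<) ⟩
  blockSize (reverse ms) v
    ≡⟨ blockSize-reverse ms v< ⟩
  blockSize (m ∷ ms) (suc (length ms ∸ suc v))
    ≡⟨ cong (blockSize (m ∷ ms)) (+-∸-assoc 1 v<) ⟨
  blockSize (m ∷ ms) (length ms ∸ v) ∎
  where open ≡-Reasoning
... | inj₂ refl = begin
  blockSize (reverse (m ∷ ms)) (length ms)
    ≡⟨ cong₂ blockSize (unfold-reverse m ms) (sym (length-reverse ms)) ⟩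
  blockSize (reverse ms ++ [ m ]) (length (reverse ms))
    ≡⟨ blockSize-++-length (reverse ms) m [] ⟩
  suc m
    ≡⟨ cong (blockSize (m ∷ ms)) (n∸n≡0 (length ms)) ⟨
  blockSize (m ∷ ms) (length ms ∸ length ms) ∎
  where open ≡-Reasoning

∑-blockSize : ∀ a L → ∑[ i < length L ] blockSize L (toℕ i) ≡ length (blocks a L)
∑-blockSize a []       = refl
∑-blockSize a (m ∷ ms) = sym (begin
  length (replicate (suc m) a ++ blocks (suc a) ms)
    ≡⟨ length-++ (replicate (suc m) a) ⟩
  length (replicate (suc m) a) + length (blocks (suc a) ms)
    ≡⟨ cong₂ _+_ (length-replicate (suc m)) (sym (∑-blockSize (suc a) ms)) ⟩
  suc m + ∑[ i < length ms ] blockSize ms (toℕ i) ∎)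
  where open ≡-Reasoning

zeros : ℕ → List Bool
zeros n = replicate n false

blockBits : List ℕ → List Bool
blockBits []           = []
blockBits (m ∷ [])     = zeros m
blockBits (m ∷ m′ ∷ ms) = zeros m ++ true ∷ blockBits (m′ ∷ ms)

digit-≡ : ∀ a → (if ⌊ a ≟ a ⌋ then false else true) ≡ false
digit-≡ a = cong (if_then false else true) (trans (isYes≗does (a ≟ a)) (dec-true (a ≟ a) refl))

digit-suc : ∀ a → (if ⌊ suc a ≟ a ⌋ then false else true) ≡ true
digit-suc a = cong (if_then false else true) (trans (isYes≗does (suc a ≟ a)) (dec-false (suc a ≟ a) 1+n≢n))

binRep-blocks : ∀ a m ms → binRep (blocks a (m ∷ ms)) ≡ blockBits (m ∷ ms)
binRep-blocks a zero    []        = refl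
binRep-blocks a zero    (m′ ∷ ms) = cong₂ _∷_ (digit-suc a) (binRep-blocks (suc a) m′ ms)
binRep-blocks a (suc m) []        = cong₂ _∷_ (digit-≡ a) (binRep-blocks a m [])
binRep-blocks a (suc m) (m′ ∷ ms) = cong₂ _∷_ (digit-≡ a) (binRep-blocks a m (m′ ∷ ms))

fromBin-blockBits : ∀ a L → L ≢ [] → fromBin a (blockBits L) ≡ blocks a L
fromBin-blockBits a []                 L≢[] = contradiction refl L≢[]
fromBin-blockBits a (zero  ∷ [])       _    = refl
fromBin-blockBits a (suc m ∷ [])       _    = cong (a ∷_) (fromBin-blockBits a (m ∷ []) (λ ()))
fromBin-blockBits a (zero  ∷ m′ ∷ ms)  _    = cong (a ∷_) (fromBin-blockBits (suc a) (m′ ∷ ms) (λ ()))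
fromBin-blockBits a (suc m ∷ m′ ∷ ms)  _    = cong (a ∷_) (fromBin-blockBits a (m ∷ m′ ∷ ms) (λ ()))

blockBits-∷ʳ-∷ʳ : ∀ xs y z → blockBits (xs ∷ʳ y ∷ʳ z) ≡ blockBits (xs ∷ʳ y) ++ true ∷ zeros z
blockBits-∷ʳ-∷ʳ []             y z = refl
blockBits-∷ʳ-∷ʳ (x ∷ [])       y z = sym (++-assoc (zeros x) (true ∷ zeros y) (true ∷ zeros z))
blockBits-∷ʳ-∷ʳ (x ∷ x′ ∷ xs) y z =
  trans (cong (λ bs → zeros x ++ true ∷ bs) (blockBits-∷ʳ-∷ʳ (x′ ∷ xs) y z))
        (sym (++-assoc (zeros x) (true ∷ blockBits (x′ ∷ xs ∷ʳ y)) (true ∷ zeros z)))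

reverse-zeros : ∀ n → reverse (zeros n) ≡ zeros n
reverse-zeros zero    = refl
reverse-zeros (suc n) = begin
  reverse (false ∷ zeros n) ≡⟨ unfold-reverse false (zeros n) ⟩
  reverse (zeros n) ∷ʳ false ≡⟨ cong (_∷ʳ false) (reverse-zeros n) ⟩
  zeros n ∷ʳ false           ≡⟨ zeros-∷ʳ n ⟩
  zeros (suc n)              ∎
  where
  open ≡-Reasoning
  zeros-∷ʳ : ∀ n → zeros n ∷ʳ false ≡ false ∷ zeros n
  zeros-∷ʳ zero    = refl
  zeros-∷ʳ (suc n) = cong (false ∷_) (zeros-∷ʳ n)

reverse-blockBits : ∀ L → reverse (blockBits L) ≡ blockBits (reverse L)
reverse-blockBits []            = refl
reverse-blockBits (m ∷ [])      = reverse-zeros m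
reverse-blockBits (m ∷ m′ ∷ ms) = begin
  reverse (zeros m ++ true ∷ blockBits (m′ ∷ ms))
    ≡⟨ reverse-++ (zeros m) (true ∷ blockBits (m′ ∷ ms)) ⟩
  reverse (true ∷ blockBits (m′ ∷ ms)) ++ reverse (zeros m)
    ≡⟨ cong₂ _++_ (unfold-reverse true (blockBits (m′ ∷ ms))) (reverse-zeros m) ⟩
  (reverse (blockBits (m′ ∷ ms)) ∷ʳ true) ++ zeros m
    ≡⟨ ++-assoc (reverse (blockBits (m′ ∷ ms))) [ true ] (zeros m) ⟩
  reverse (blockBits (m′ ∷ ms)) ++ true ∷ zeros m
    ≡⟨ cong (_++ true ∷ zeros m) (trans (reverse-blockBits (m′ ∷ ms)) (cong blockBits (unfold-reverse m′ ms))) ⟩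
  blockBits (reverse ms ∷ʳ m′) ++ true ∷ zeros m
    ≡⟨ blockBits-∷ʳ-∷ʳ (reverse ms) m′ m ⟨
  blockBits (reverse ms ∷ʳ m′ ∷ʳ m)
    ≡⟨ cong (λ xs → blockBits (xs ∷ʳ m)) (unfold-reverse m′ ms) ⟨
  blockBits (reverse (m′ ∷ ms) ∷ʳ m)
    ≡⟨ cong blockBits (unfold-reverse m (m′ ∷ ms)) ⟨
  blockBits (reverse (m ∷ m′ ∷ ms)) ∎
  where open ≡-Reasoning

reverseSeq-blocks : ∀ m ms → reverseSeq (blocks 0 (m ∷ ms)) ≡ blocks 0 (reverse (m ∷ ms))
reverseSeq-blocks m ms = begin
  fromBin 0 (reverse (binRep (blocks 0 (m ∷ ms))))
    ≡⟨ cong (fromBin 0 ∘ reverse) (binRep-blocks 0 m ms) ⟩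
  fromBin 0 (reverse (blockBits (m ∷ ms)))
    ≡⟨ cong (fromBin 0) (reverse-blockBits (m ∷ ms)) ⟩
  fromBin 0 (blockBits (reverse (m ∷ ms)))
    ≡⟨ fromBin-blockBits 0 (reverse (m ∷ ms)) reverse≢[] ⟩
  blocks 0 (reverse (m ∷ ms)) ∎
  where
  open ≡-Reasoning
  reverse≢[] : reverse (m ∷ ms) ≢ []
  reverse≢[] eq = contradiction (trans (sym (reverse-involutive (m ∷ ms))) (cong reverse eq)) λ ()

blocks-duality : ∀ m m′ ms k f → let L = m ∷ m′ ∷ ms in
  HasBoundedSolution (blocks 0 L) k f ⇔
  HasBoundedSolution (blocks 0 (reverse L)) k (length (blocks 0 L) * k ∸ f)
blocks-duality m m′ ms k f =
  subst₂ (λ n n′ → BoundedSolution n (λ v → countEq v S) k f ⇔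
                   BoundedSolution n′ (λ v → countEq v S′) k (length S * k ∸ f))
         (sym (numDistinct-blocks L))
         (sym (trans (numDistinct-blocks (reverse L)) (length-reverse L)))
         (solution-duality {c = λ v → countEq v S} {c′ = λ v → countEq v S′}
                           f positive reversed ∑-weights)
  where
  L = m ∷ m′ ∷ ms
  S = blocks 0 L
  S′ = blocks 0 (reverse L)
  positive : ∀ (i : Fin (length L)) → 1 ≤ countEq (toℕ i) S
  positive i = subst (1 ≤_) (sym (countEq-blocks 0 L (toℕ i))) (blockSize-positive L (toℕ<n i))
  reversed : ∀ (i : Fin (length L)) → countEq (toℕ i) S′ ≡ countEq (toℕ (opposite i)) S
  reversed i = begin
    countEq (toℕ i) S′                   ≡⟨ countEq-blocks 0 (reverse L) (toℕ i) ⟩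
    blockSize (reverse L) (toℕ i)        ≡⟨ blockSize-reverse L (toℕ<n i) ⟩
    blockSize L (length L ∸ suc (toℕ i)) ≡⟨ cong (blockSize L) (opposite-prop i) ⟨
    blockSize L (toℕ (opposite i))       ≡⟨ countEq-blocks 0 L (toℕ (opposite i)) ⟨
    countEq (toℕ (opposite i)) S         ∎
    where open ≡-Reasoning
  ∑-weights : ∑[ i < length L ] countEq (toℕ i) S ≡ length S
  ∑-weights = trans (sum-cong-≗ {length L} (countEq-blocks 0 L ∘ toℕ)) (∑-blockSize 0 L)

mainTheorem13 : (p : ℕ) (s : List ℕ) → IsSortingSeq s → length s ≡ p →
    1 < numDistinct s → (k : ℕ) → 1 ≤ k → (f : ℕ) →
    HasBoundedSolution s k f ⇔ HasBoundedSolution (reverseSeq s) k (p * k ∸ f)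
mainTheorem13 p s (sorting steps) refl r>1 k _ f with sortingSeq⇒blocks steps
... | m , [] , refl = contradiction (subst (1 <_) (numDistinct-blocks (m ∷ [])) r>1) (<-irrefl refl)
... | m , m′ ∷ ms , refl =
  subst (λ s′ → HasBoundedSolution (blocks 0 (m ∷ m′ ∷ ms)) k f ⇔
                HasBoundedSolution s′ k (length (blocks 0 (m ∷ m′ ∷ ms)) * k ∸ f))
        (sym (reverseSeq-blocks m (m′ ∷ ms)))
        (blocks-duality m m′ ms k f)
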